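{- Let $d\ge1$ with $d\notin\{1,2,4\}$ and let $g\in\mathrm{Aut}(Y(d))$. Then $g$ is twin-preserving, i.e., for every $x\in L(d)$ we have $g(x)\in L(d)$ and $g(x')=g(x)'$.
   Context: For $d\ge1$, let $A(d)$, $B(d)$ be disjoint sets with $|A(d)|=|B(d)|=d$ and let $a\mapsto a'$ be a bijection from $A(d)$ onto $B(d)$; extend it to $L(d)=A(d)\cup B(d)$ by $(a')':=a$. Let $M(d)$ be the set of subsets of $A(d)$ of even cardinality, regarded as new vertices. The CFI-gadget $Y(d)$ is the graph with vertex set $A(d)\cup B(d)\cup M(d)$ whose edges are $\{a,m\}$ for $a\in m$ and $\{a',m\}$ for $a\notin m$ ($a\in A(d)$, $m\in M(d)$). -}

module Defs where

open import Data.Nat using (ℕ; suc)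
open import Data.Nat.Properties using (_≟_)
open import Data.Bool using (Bool; true; false; T; not)
open import Data.Fin using (Fin)
open import Data.Fin.Subset using (Subset; _∈_; _∉_; ∣_∣)
open import Data.Empty using (⊥)
open import Data.Unit using (⊤)
open import Data.Product using (_×_; Σ)
open import Function.Bundles using (_⤖_; Bijection; _⇔_)
open import Relation.Binary.PropositionalEquality using (_≡_)

even : ℕ → Bool
even 0 = true
even (suc n) = not (even n)

-- Vertices of the CFI-gadget Y(d):
--   inA a  : the vertex a ∈ A(d)   (A(d) ≅ Fin d)
--   inB a  : the twin vertex a' ∈ B(d)
--   inM m  : an even-cardinality subset m of A(d)
-- (the evenness witness lives in T, which is ⊤ or ⊥, so it is unique)
data Vertex (d : ℕ) : Set where
  inA : Fin d → Vertex d
  inB : Fin d → Vertex d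
  inM : (m : Subset d) → T (even ∣ m ∣) → Vertex d

Adj : {d : ℕ} → Vertex d → Vertex d → Set
Adj (inA a) (inM m _) = a ∈ m
Adj (inB a) (inM m _) = a ∉ m
Adj (inM m _) (inA a) = a ∈ m
Adj (inM m _) (inB a) = a ∉ m
Adj _ _ = ⊥

InL : {d : ℕ} → Vertex d → Set
InL (inA _) = ⊤
InL (inB _) = ⊤
InL (inM _ _) = ⊥

twin : {d : ℕ} → Vertex d → Vertex d
twin (inA a) = inB a
twin (inB a) = inA a
twin (inM m p) = inM m p

record Aut (d : ℕ) : Set where
  field
    bij : Vertex d ⤖ Vertex d
  open Bijection bij public using (to)
  field
    adj : ∀ u v → Adj u v ⇔ Adj (to u) (to v)

TwinPreserving : {d : ℕ} → Aut d → Set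
TwinPreserving {d} g =
  ∀ (x : Vertex d) → InL x → InL (Aut.to g x) × (Aut.to g (twin x) ≡ twin (Aut.to g x))

-- Write a ∈ A(d) as the literal lit true a and its twin a′ as lit false a; then lit b i is adjacent
-- to an even set m exactly when m has bit b at i.  An automorphism g maps L(d) into L(d): for d = 3,
-- literals have two neighbours and the vertices of M(d) three; for d ≥ 5, every literal has two
-- neighbours sharing at most one neighbour besides it, while any two neighbours of m ∈ M(d) share
-- at least two neighbours besides m (flip m at two coordinates avoiding theirs).  Finally, for d ≥ 3
-- two distinct literals without a common neighbour are twins, because an even set can prescribe
-- two of its bits by fixing the parity at a third coordinate; g preserves this relation.
module Submission where

open import Defs
open import Data.Nat using (ℕ; suc; _+_; _≤_; _<_)
open import Data.Nat.Properties using (≤-refl; m≤m+n; <⇒≤)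
open import Data.Bool using (Bool; true; false; not; T; if_then_else_)
open import Data.Bool.Properties using (not-involutive; not-¬; ¬-not)
open import Data.Empty using (⊥; ⊥-elim)
open import Data.Unit using (tt)
open import Data.Fin using (Fin; zero; suc; _≟_; inject≤)
open import Data.Fin.Properties using (¬∀⟶∃¬; pigeonhole; <-irrefl; inject≤-injective; 0≢1+n; suc-injective)
open import Data.Fin.Subset using (Subset; ∣_∣)
open import Data.Vec using ([]; _∷_; here; there; lookup; replicate; _[_]%=_; _[_]≔_)
open import Data.Vec.Properties using ([]=⇒lookup; lookup⇒[]=; lookup∘updateAt; lookup∘updateAt′; lookup∘update; lookup∘update′; lookup-replicate)
open import Data.List as List using (List; []; _∷_; length)
open import Data.List.Relation.Unary.All using (All; []; _∷_)
open import Data.List.Relation.Unary.All.Properties using (¬Any⇒All¬)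
open import Data.List.Relation.Unary.Any using (Any; index; any?)
open import Data.List.Relation.Unary.Any.Properties using (lookup-index)
open import Data.Product using (Σ-syntax; ∃; ∃₂; _×_; _,_; map₂)
open import Data.Sum as Sum using (_⊎_; inj₁; inj₂)
open import Function using (_∘_)
open import Function.Bundles using (Bijection; Surjection; Equivalence)
open import Function.Definitions using (Injective)
open import Relation.Nullary using (¬_; yes; no)
open import Relation.Binary.PropositionalEquality using (_≡_; _≢_; refl; sym; trans; cong; subst)

fresh : ∀ {n} (xs : List (Fin n)) → length xs < n → ∃ λ k → All (k ≢_) xs
fresh {n} xs len<n =
  map₂ (¬Any⇒All¬ xs) (¬∀⟶∃¬ n (λ k → Any (k ≡_) xs) (λ k → any? (k ≟_) xs) not-all-listed)
  where
  not-all-listed : ¬ (∀ k → Any (k ≡_) xs)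
  not-all-listed listed with pigeonhole len<n (index ∘ listed)
  ... | i , j , i<j , same-index = <-irrefl i≡j i<j
    where
    i≡j : i ≡ j
    i≡j = trans (lookup-index (listed i))
                (trans (cong (List.lookup xs) same-index) (sym (lookup-index (listed j))))

no-three-among-two : ∀ {a} {A : Set a} {u v : A} (f : Fin 3 → A) → Injective _≡_ _≡_ f →
                     (∀ k → f k ≡ u ⊎ f k ≡ v) → ⊥
no-three-among-two {A = A} {u} {v} f f-inj cover =
  among (cover zero) (cover (suc zero)) (cover (suc (suc zero)))
  where
  collide : ∀ {i j} {w : A} → f i ≡ w → f j ≡ w → i ≡ j
  collide {i} {j} p q = f-inj {i} {j} (trans p (sym q))

  Covered : Fin 3 → Set _
  Covered k = f k ≡ u ⊎ f k ≡ v

  among : Covered zero → Covered (suc zero) → Covered (suc (suc zero)) → ⊥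
  among (inj₁ p) (inj₁ q) _        = 0≢1+n (collide p q)
  among (inj₂ p) (inj₂ q) _        = 0≢1+n (collide p q)
  among (inj₁ p) (inj₂ _) (inj₁ r) = 0≢1+n (collide p r)
  among (inj₂ p) (inj₁ _) (inj₂ r) = 0≢1+n (collide p r)
  among (inj₁ _) (inj₂ q) (inj₂ r) = 0≢1+n (suc-injective (collide q r))
  among (inj₂ _) (inj₁ q) (inj₁ r) = 0≢1+n (suc-injective (collide q r))

not-two-besides : ∀ {a} {A : Set a} {x z n₁ n₂ : A} → n₁ ≢ n₂ → n₁ ≢ x → n₂ ≢ x →
                  n₁ ≡ x ⊎ n₁ ≡ z → n₂ ≡ x ⊎ n₂ ≡ z → ⊥
not-two-besides _     n₁≢x _     (inj₁ n₁≡x) _           = n₁≢x n₁≡x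
not-two-besides _     _    n₂≢x  (inj₂ _)    (inj₁ n₂≡x) = n₂≢x n₂≡x
not-two-besides n₁≢n₂ _    _     (inj₂ n₁≡z) (inj₂ n₂≡z) = n₁≢n₂ (trans n₁≡z (sym n₂≡z))

≡not⇒≢ : ∀ {x y} → x ≡ not y → x ≢ y
≡not⇒≢ x≡¬y x≡y = not-¬ refl (trans (sym x≡y) x≡¬y)

toggle : ∀ {n} → Fin n → Subset n → Subset n
toggle i m = m [ i ]%= not

even-toggle : ∀ {n} (i : Fin n) m → even ∣ toggle i m ∣ ≡ not (even ∣ m ∣)
even-toggle zero    (true  ∷ m) = sym (not-involutive _)
even-toggle zero    (false ∷ m) = refl
even-toggle (suc i) (true  ∷ m) = cong not (even-toggle i m)
even-toggle (suc i) (false ∷ m) = even-toggle i m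

even-toggle₂ : ∀ {n} (i j : Fin n) m → even ∣ toggle i (toggle j m) ∣ ≡ even ∣ m ∣
even-toggle₂ i j m = trans (even-toggle i (toggle j m)) (trans (cong not (even-toggle j m)) (not-involutive _))

lookup-toggle : ∀ {n} (i : Fin n) m → lookup (toggle i m) i ≡ not (lookup m i)
lookup-toggle i m = lookup∘updateAt i m

lookup-toggle′ : ∀ {n} {i k : Fin n} m → i ≢ k → lookup (toggle i m) k ≡ lookup m k
lookup-toggle′ {i = i} {k} m i≢k = lookup∘updateAt′ k i (i≢k ∘ sym) m

fixParityAt : ∀ {n} → Fin n → Subset n → Subset n
fixParityAt k m = if even ∣ m ∣ then m else toggle k m

fixParityAt-even : ∀ {n} (k : Fin n) m → T (even ∣ fixParityAt k m ∣)
fixParityAt-even k m with even ∣ m ∣ in m-even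
... | true  = subst T (sym m-even) tt
... | false = subst T (sym (trans (even-toggle k m) (cong not m-even))) tt

lookup-fixParityAt : ∀ {n} {k j : Fin n} m → k ≢ j → lookup (fixParityAt k m) j ≡ lookup m j
lookup-fixParityAt m k≢j with even ∣ m ∣
... | true  = refl
... | false = lookup-toggle′ m k≢j

module _ {d : ℕ} where

  lit : Bool → Fin d → Vertex d
  lit true  = inA
  lit false = inB

  lit-view : ∀ x → InL x → ∃₂ λ b i → x ≡ lit b i
  lit-view (inA i) _ = true  , i , refl
  lit-view (inB i) _ = false , i , refl

  lit-injectiveʳ : ∀ {b b′ i j} → lit b i ≡ lit b′ j → i ≡ j
  lit-injectiveʳ {true}  {true}  refl = refl
  lit-injectiveʳ {false} {false} refl = refl

  twin-lit : ∀ b i → twin (lit b i) ≡ lit (not b) i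
  twin-lit true  i = refl
  twin-lit false i = refl

  Adj-sym : (u v : Vertex d) → Adj u v → Adj v u
  Adj-sym (inA _)   (inM _ _) uv = uv
  Adj-sym (inB _)   (inM _ _) uv = uv
  Adj-sym (inM _ _) (inA _)   uv = uv
  Adj-sym (inM _ _) (inB _)   uv = uv

  lookup⇒adj : ∀ {m : Subset d} {p i} b → lookup m i ≡ b → Adj (inM m p) (lit b i)
  lookup⇒adj {m} {i = i} true  mi≡b = lookup⇒[]= i m mi≡b
  lookup⇒adj             false mi≡b = λ i∈m → not-¬ ([]=⇒lookup i∈m) mi≡b

  adj⇒lookup : ∀ {m : Subset d} {p i} b → Adj (inM m p) (lit b i) → lookup m i ≡ b
  adj⇒lookup                 true  i∈m = []=⇒lookup i∈m
  adj⇒lookup {m} {i = i}     false i∉m with lookup m i in mi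
  ... | true  = ⊥-elim (i∉m (lookup⇒[]= i m mi))
  ... | false = refl

  M-neighbour : ∀ {m p} w → Adj (inM m p) w → ∃ λ k → w ≡ lit (lookup m k) k
  M-neighbour {p = p} (inA k) k∈m = k , cong (λ b → lit b k) (sym (adj⇒lookup {p = p} true  k∈m))
  M-neighbour {p = p} (inB k) k∉m = k , cong (λ b → lit b k) (sym (adj⇒lookup {p = p} false k∉m))

  M-common-neighbour : ∀ {m m′ p p′} w → Adj (inM m p) w → Adj (inM m′ p′) w →
                       ∃ λ k → w ≡ lit (lookup m k) k × lookup m′ k ≡ lookup m k
  M-common-neighbour {p′ = p′} w m-w m′-w with M-neighbour w m-w
  ... | k , refl = k , refl , adj⇒lookup {p = p′} _ m′-w

  inM-≢ : ∀ {n n′ : Subset d} {p p′} k → lookup n k ≢ lookup n′ k → inM n p ≢ inM n′ p′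
  inM-≢ k nk≢n′k refl = nk≢n′k refl

  SparseNeighbourPair : Vertex d → Set
  SparseNeighbourPair x = Σ[ u ∈ Vertex d ] Σ[ v ∈ Vertex d ] Σ[ z ∈ Vertex d ]
    Adj x u × Adj x v × (∀ w → Adj u w → Adj v w → w ≡ x ⊎ w ≡ z)

  L-sparse : 2 ≤ d → ∀ x → InL x → SparseNeighbourPair x
  L-sparse 2≤d x x∈L with lit-view x x∈L
  ... | b , i , refl with fresh (i ∷ []) 2≤d
  ... | c , c≢i ∷ [] =
    u , v , lit (lookup m₁ c) c , Adj-sym u _ (lookup⇒adj b m₁-i) , Adj-sym v _ (lookup⇒adj b m₂-i) , meet
    where
    -- m₁ and m₂ agree at i and nowhere else except possibly at c
    r₁ r₂ m₁ m₂ : Subset d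
    r₁ = replicate d b
    r₂ = replicate d (not b) [ i ]≔ b
    m₁ = fixParityAt c r₁
    m₂ = fixParityAt c r₂
    u v : Vertex d
    u = inM m₁ (fixParityAt-even c r₁)
    v = inM m₂ (fixParityAt-even c r₂)
    m₁-off-c : ∀ {k} → c ≢ k → lookup m₁ k ≡ b
    m₁-off-c {k} c≢k = trans (lookup-fixParityAt r₁ c≢k) (lookup-replicate k b)
    m₁-i : lookup m₁ i ≡ b
    m₁-i = m₁-off-c c≢i
    m₂-i : lookup m₂ i ≡ b
    m₂-i = trans (lookup-fixParityAt r₂ c≢i) (lookup∘update i (replicate d (not b)) b)
    m₂-off-ci : ∀ {k} → c ≢ k → k ≢ i → lookup m₂ k ≡ not b
    m₂-off-ci {k} c≢k k≢i = trans (lookup-fixParityAt r₂ c≢k)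
      (trans (lookup∘update′ k≢i (replicate d (not b)) b) (lookup-replicate k (not b)))
    meet : ∀ w → Adj u w → Adj v w → w ≡ lit b i ⊎ w ≡ lit (lookup m₁ c) c
    meet w u-w v-w with M-common-neighbour w u-w v-w
    ... | k , refl , agree with c ≟ k | k ≟ i
    ...   | yes refl | _        = inj₂ refl
    ...   | no _     | yes refl = inj₁ (cong (λ b → lit b i) m₁-i)
    ...   | no c≢k   | no k≢i   =
      ⊥-elim (≡not⇒≢ (trans (sym agree) (m₂-off-ci c≢k k≢i)) (m₁-off-c c≢k))

  M-not-sparse : 5 ≤ d → ∀ {m p} → ¬ SparseNeighbourPair (inM m p)
  M-not-sparse 5≤d {m} {p} (u , v , z , m-u , m-v , meet)
    with M-neighbour u m-u | M-neighbour v m-v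
  ... | i , refl | j , refl
    with fresh (i ∷ j ∷ []) (<⇒≤ (<⇒≤ 5≤d))
  ... | a , a≢i ∷ a≢j ∷ []
    with fresh (i ∷ j ∷ a ∷ []) (<⇒≤ 5≤d)
  ... | b , b≢i ∷ b≢j ∷ b≢a ∷ []
    with fresh (i ∷ j ∷ a ∷ b ∷ []) 5≤d
  ... | c , c≢i ∷ c≢j ∷ c≢a ∷ c≢b ∷ [] =
    not-two-besides (inM-≢ a n₁≢n₂-at-a) (inM-≢ a n₁≢m-at-a) (inM-≢ c n₂≢m-at-c)
      (meet n₁ (Adj-sym n₁ _ (lookup⇒adj _ (kept a≢i b≢i))) (Adj-sym n₁ _ (lookup⇒adj _ (kept a≢j b≢j))))
      (meet n₂ (Adj-sym n₂ _ (lookup⇒adj _ (kept c≢i b≢i))) (Adj-sym n₂ _ (lookup⇒adj _ (kept c≢j b≢j))))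
    where
    n₁ n₂ : Vertex d
    n₁ = inM (toggle a (toggle b m)) (subst T (sym (even-toggle₂ a b m)) p)
    n₂ = inM (toggle c (toggle b m)) (subst T (sym (even-toggle₂ c b m)) p)
    kept : ∀ {x k} → x ≢ k → b ≢ k → lookup (toggle x (toggle b m)) k ≡ lookup m k
    kept x≢k b≢k = trans (lookup-toggle′ (toggle b m) x≢k) (lookup-toggle′ m b≢k)
    toggled : ∀ {x} → b ≢ x → lookup (toggle x (toggle b m)) x ≡ not (lookup m x)
    toggled {x} b≢x = trans (lookup-toggle x (toggle b m)) (cong not (lookup-toggle′ m b≢x))
    n₁≢m-at-a : lookup (toggle a (toggle b m)) a ≢ lookup m a
    n₁≢m-at-a = ≡not⇒≢ (toggled b≢a)
    n₂≢m-at-c : lookup (toggle c (toggle b m)) c ≢ lookup m c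
    n₂≢m-at-c = ≡not⇒≢ (toggled (c≢b ∘ sym))
    n₁≢n₂-at-a : lookup (toggle a (toggle b m)) a ≢ lookup (toggle c (toggle b m)) a
    n₁≢n₂-at-a = ≡not⇒≢ (trans (toggled b≢a) (cong not (sym (kept c≢a b≢a))))

  ThreeNeighbours : Vertex d → Set
  ThreeNeighbours x = Σ[ f ∈ (Fin 3 → Vertex d) ] Injective _≡_ _≡_ f × (∀ k → Adj x (f k))

  M-three-neighbours : 3 ≤ d → ∀ {m p} → ThreeNeighbours (inM m p)
  M-three-neighbours 3≤d {m} = neighbour , neighbour-injective , λ k → lookup⇒adj _ refl
    where
    neighbour : Fin 3 → Vertex d
    neighbour k = lit (lookup m (inject≤ k 3≤d)) (inject≤ k 3≤d)
    neighbour-injective : Injective _≡_ _≡_ neighbour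
    neighbour-injective {k} {k′} same = inject≤-injective 3≤d 3≤d k k′ (lit-injectiveʳ same)

  NoCommonNeighbour : Vertex d → Vertex d → Set
  NoCommonNeighbour x y = ∀ w → Adj x w → Adj y w → ⊥

  twin-InL : (x : Vertex d) → InL x → InL (twin x)
  twin-InL (inA _) _ = tt
  twin-InL (inB _) _ = tt

  twin-≢ : (x : Vertex d) → InL x → x ≢ twin x
  twin-≢ (inA _) _ ()
  twin-≢ (inB _) _ ()

  twin-no-common-neighbour : ∀ x → InL x → NoCommonNeighbour x (twin x)
  twin-no-common-neighbour (inA _) _ (inM _ _) i∈m i∉m = i∉m i∈m
  twin-no-common-neighbour (inB _) _ (inM _ _) i∉m i∈m = i∉m i∈m

  no-common-neighbour⇒twin : 3 ≤ d → ∀ x y → InL x → InL y → x ≢ y → NoCommonNeighbour x y → y ≡ twin x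
  no-common-neighbour⇒twin 3≤d x y x∈L y∈L x≢y apart with lit-view x x∈L | lit-view y y∈L
  ... | b , i , refl | b′ , j , refl with i ≟ j
  ...   | yes refl = trans (cong (λ c → lit c i) (¬-not (x≢y ∘ cong (λ c → lit c i) ∘ sym))) (sym (twin-lit b i))
  ...   | no i≢j with fresh (i ∷ j ∷ []) 3≤d
  ...     | k , k≢i ∷ k≢j ∷ [] = ⊥-elim (apart w (Adj-sym w _ (lookup⇒adj b m-i)) (Adj-sym w _ (lookup⇒adj b′ m-j)))
    where
    r m : Subset d
    r = replicate d b [ j ]≔ b′
    m = fixParityAt k r
    w : Vertex d
    w = inM m (fixParityAt-even k r)
    m-i : lookup m i ≡ b
    m-i = trans (lookup-fixParityAt r k≢i) (trans (lookup∘update′ i≢j (replicate d b) b′) (lookup-replicate i b))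
    m-j : lookup m j ≡ b′
    m-j = trans (lookup-fixParityAt r k≢j) (lookup∘update j (replicate d b) b′)

inA-neighbours₃ : ∀ i → ∃₂ λ (u v : Vertex 3) → ∀ w → Adj (inA i) w → w ≡ u ⊎ w ≡ v
inA-neighbours₃ zero = inM (true ∷ true ∷ false ∷ []) tt , inM (true ∷ false ∷ true ∷ []) tt , λ where
  (inM (true ∷ true  ∷ false ∷ []) _)  _ → inj₁ refl
  (inM (true ∷ false ∷ true  ∷ []) _)  _ → inj₂ refl
  (inM (true ∷ true  ∷ true  ∷ []) ()) _
  (inM (true ∷ false ∷ false ∷ []) ()) _
  (inM (false ∷ _) _) ()
  (inA _) ()
  (inB _) ()
inA-neighbours₃ (suc zero) = inM (true ∷ true ∷ false ∷ []) tt , inM (false ∷ true ∷ true ∷ []) tt , λ where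
  (inM (true  ∷ true ∷ false ∷ []) _)  _ → inj₁ refl
  (inM (false ∷ true ∷ true  ∷ []) _)  _ → inj₂ refl
  (inM (true  ∷ true ∷ true  ∷ []) ()) _
  (inM (false ∷ true ∷ false ∷ []) ()) _
  (inM (_ ∷ false ∷ _) _) (there ())
  (inA _) ()
  (inB _) ()
inA-neighbours₃ (suc (suc zero)) = inM (true ∷ false ∷ true ∷ []) tt , inM (false ∷ true ∷ true ∷ []) tt , λ where
  (inM (true  ∷ false ∷ true ∷ []) _)  _ → inj₁ refl
  (inM (false ∷ true  ∷ true ∷ []) _)  _ → inj₂ refl
  (inM (true  ∷ true  ∷ true ∷ []) ()) _
  (inM (false ∷ false ∷ true ∷ []) ()) _
  (inM (_ ∷ _ ∷ false ∷ []) _) (there (there ()))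
  (inA _) ()
  (inB _) ()

inB-neighbours₃ : ∀ i → ∃₂ λ (u v : Vertex 3) → ∀ w → Adj (inB i) w → w ≡ u ⊎ w ≡ v
inB-neighbours₃ zero = inM (false ∷ false ∷ false ∷ []) tt , inM (false ∷ true ∷ true ∷ []) tt , λ where
  (inM (false ∷ false ∷ false ∷ []) _)  _ → inj₁ refl
  (inM (false ∷ true  ∷ true  ∷ []) _)  _ → inj₂ refl
  (inM (false ∷ true  ∷ false ∷ []) ()) _
  (inM (false ∷ false ∷ true  ∷ []) ()) _
  (inM (true ∷ _) _) 0∉m → ⊥-elim (0∉m here)
  (inA _) ()
  (inB _) ()
inB-neighbours₃ (suc zero) = inM (false ∷ false ∷ false ∷ []) tt , inM (true ∷ false ∷ true ∷ []) tt , λ where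
  (inM (false ∷ false ∷ false ∷ []) _)  _ → inj₁ refl
  (inM (true  ∷ false ∷ true  ∷ []) _)  _ → inj₂ refl
  (inM (true  ∷ false ∷ false ∷ []) ()) _
  (inM (false ∷ false ∷ true  ∷ []) ()) _
  (inM (_ ∷ true ∷ _) _) 1∉m → ⊥-elim (1∉m (there here))
  (inA _) ()
  (inB _) ()
inB-neighbours₃ (suc (suc zero)) = inM (false ∷ false ∷ false ∷ []) tt , inM (true ∷ true ∷ false ∷ []) tt , λ where
  (inM (false ∷ false ∷ false ∷ []) _)  _ → inj₁ refl
  (inM (true  ∷ true  ∷ false ∷ []) _)  _ → inj₂ refl
  (inM (true  ∷ false ∷ false ∷ []) ()) _
  (inM (false ∷ true  ∷ false ∷ []) ()) _
  (inM (_ ∷ _ ∷ true ∷ []) _) 2∉m → ⊥-elim (2∉m (there (there here)))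
  (inA _) ()
  (inB _) ()

L-neighbours₃ : ∀ x → InL x → ∃₂ λ (u v : Vertex 3) → ∀ w → Adj x w → w ≡ u ⊎ w ≡ v
L-neighbours₃ (inA i) _ = inA-neighbours₃ i
L-neighbours₃ (inB i) _ = inB-neighbours₃ i

L-not-three-neighbours₃ : ∀ x → InL x → ¬ ThreeNeighbours x
L-not-three-neighbours₃ x x∈L (f , f-inj , x-f) with L-neighbours₃ x x∈L
... | u , v , cover = no-three-among-two f f-inj (λ k → cover (f k) (x-f k))

module Automorphism {d : ℕ} (g : Aut d) where
  open Aut g using (to; bij)

  from : Vertex d → Vertex d
  from = Bijection.to⁻ bij

  to∘from : ∀ y → to (from y) ≡ y
  to∘from = Surjection.to∘to⁻ (Bijection.surjection bij)

  adj⁺ : ∀ {u v} → Adj u v → Adj (to u) (to v)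
  adj⁺ {u} {v} = Equivalence.to (Aut.adj g u v)

  adj-from : ∀ {u w} → Adj (to u) w → Adj u (from w)
  adj-from {u} {w} u-w = Equivalence.from (Aut.adj g u (from w)) (subst (Adj (to u)) (sym (to∘from w)) u-w)

  sparse-preserved : ∀ {x} → SparseNeighbourPair x → SparseNeighbourPair (to x)
  sparse-preserved {x} (u , v , z , x-u , x-v , meet) = to u , to v , to z , adj⁺ x-u , adj⁺ x-v , meet′
    where
    meet′ : ∀ w → Adj (to u) w → Adj (to v) w → w ≡ to x ⊎ w ≡ to z
    meet′ w u-w v-w = Sum.map pushed pushed (meet (from w) (adj-from u-w) (adj-from v-w))
      where
      pushed : ∀ {y} → from w ≡ y → w ≡ to y
      pushed from-w≡y = trans (sym (to∘from w)) (cong to from-w≡y)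

  three-neighbours-reflected : ∀ {x} → ThreeNeighbours (to x) → ThreeNeighbours x
  three-neighbours-reflected (f , f-inj , x-f) = from ∘ f , from∘f-injective , adj-from ∘ x-f
    where
    from∘f-injective : Injective _≡_ _≡_ (from ∘ f)
    from∘f-injective same = f-inj (trans (sym (to∘from _)) (trans (cong to same) (to∘from _)))

  no-common-neighbour-preserved : ∀ {x y} → NoCommonNeighbour x y → NoCommonNeighbour (to x) (to y)
  no-common-neighbour-preserved apart w x-w y-w = apart (from w) (adj-from x-w) (adj-from y-w)

  InL-preserved₅ : 5 ≤ d → ∀ x → InL x → InL (to x)
  InL-preserved₅ 5≤d x x∈L with to x | sparse-preserved (L-sparse (<⇒≤ (<⇒≤ (<⇒≤ 5≤d))) x x∈L)
  ... | inA _   | _      = tt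
  ... | inB _   | _      = tt
  ... | inM _ _ | sparse = M-not-sparse 5≤d sparse

  twin-preserving : 3 ≤ d → (∀ x → InL x → InL (to x)) → TwinPreserving g
  twin-preserving 3≤d L→L x x∈L = L→L x x∈L ,
    no-common-neighbour⇒twin 3≤d (to x) (to (twin x)) (L→L x x∈L) (L→L (twin x) (twin-InL x x∈L))
      (twin-≢ x x∈L ∘ Bijection.injective bij) (no-common-neighbour-preserved (twin-no-common-neighbour x x∈L))

InL-preserved₃ : (g : Aut 3) → ∀ x → InL x → InL (Aut.to g x)
InL-preserved₃ g x x∈L with Aut.to g x in gx
... | inA _   = tt
... | inB _   = tt
... | inM _ _ = L-not-three-neighbours₃ x x∈L
                  (Automorphism.three-neighbours-reflected g (subst ThreeNeighbours (sym gx) (M-three-neighbours ≤-refl)))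

proposition5p9 : (d : ℕ) → 1 ≤ d → d ≢ 1 → d ≢ 2 → d ≢ 4 → (g : Aut d) → TwinPreserving g
proposition5p9 0 () _ _ _ _
proposition5p9 1 _ d≢1 _ _ _ = ⊥-elim (d≢1 refl)
proposition5p9 2 _ _ d≢2 _ _ = ⊥-elim (d≢2 refl)
proposition5p9 3 _ _ _ _ g = Automorphism.twin-preserving g ≤-refl (InL-preserved₃ g)
proposition5p9 4 _ _ _ d≢4 _ = ⊥-elim (d≢4 refl)
proposition5p9 (suc (suc (suc (suc (suc e))))) _ _ _ _ g =
  Automorphism.twin-preserving g (m≤m+n 3 (2 + e)) (Automorphism.InL-preserved₅ g (m≤m+n 5 e))
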